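{- Let $G=(V,E)$ be a connected graph on $n$ vertices with maximum degree $\Delta$, accessible through a shortest path distance oracle, let $\mathcal{T}=(\mathcal{P},\mathcal{E})$ be the layering tree of $G$ with respect to a vertex $s$, and let $\ell\geq\ell(\mathcal{T})$. Let $k\geq 0$ and $i=k+\ell+2$. Suppose the layers $L_0,L_1,\dots$, the graph $G_i$, and the tree $\mathcal{T}_k$ are given. Then there is an algorithm that computes $G_{i+1}$ using $O\big(|L_i|(\Delta^{\ell+2}\log n+\Delta^{4\ell+8})\big)$ shortest path queries.
   Context: All graphs are simple, unweighted, undirected; $d_G$ is shortest-path distance, and a shortest path query returns $d_G(u,v)$ for given $u,v\in V$. For the vertex $s$, the BFS layers are $L_i=\{v: d_G(s,v)=i\}$, $L_{\le j}=\bigcup_{i\le j}L_i$, $L_{\le -1}=\emptyset$. $G_i$ denotes the induced subgraph $G[L_{\le i-1}]$. For each $i\ge 0$, let $S_i^1,\dots,S_i^{s_i}$ be the connected components of $G\setminus L_{\le i-1}$ and $P_i^j=S_i^j\cap L_i$; these nonempty sets are the parts at layer $i$, $\mathcal{P}_i$ is the set of parts at layer $i$, and $\mathcal{P}=\bigcup_i\mathcal{P}_i$. The layering tree $\mathcal{T}=(\mathcal{P},\mathcal{E})$ has the parts as vertices, with $P,P'$ adjacent iff some $u\in P$, $u'\in P'$ are adjacent in $G$. $\mathcal{T}_k$ is the subtree of $\mathcal{T}$ induced by the parts at layers $0,\dots,k-1$. The length of $\mathcal{T}$ is $\ell(\mathcal{T})=\max_{P\in\mathcal{P}}\max_{u,v\in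 P} d_G(u,v)$. -}

module Defs where

open import Data.Nat using (ℕ; zero; suc; _+_; _*_; _≤_; _<_; _<ᵇ_)
open import Data.Nat.Logarithm using (⌈log₂_⌉)
open import Data.Fin using (Fin)
open import Data.Bool using (Bool; true; false; _∧_; if_then_else_)
open import Data.List using (List; map; allFin)
open import Data.Nat.ListAction using (sum)
open import Data.Product using (Σ; ∃; _×_; _,_)
open import Data.Unit using (⊤)
open import Relation.Binary.PropositionalEquality using (_≡_)
open import Function.Bundles using (_⇔_)

record Graph (n : ℕ) : Set where
  field
    adj    : Fin n → Fin n → Bool
    sym    : ∀ u v → adj u v ≡ adj v u
    irrefl : ∀ u → adj u u ≡ false
open Graph public

data WalkIn {n : ℕ} (G : Graph n) (P : Fin n → Set) : Fin n → Fin n → ℕ → Set where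
  here : ∀ {u} → P u → WalkIn G P u u 0
  step : ∀ {u w v m} → P u → adj G u w ≡ true → WalkIn G P w v m → WalkIn G P u v (suc m)

Walk : {n : ℕ} → Graph n → Fin n → Fin n → ℕ → Set
Walk G = WalkIn G (λ _ → ⊤)

Connected : {n : ℕ} → Graph n → Set
Connected G = ∀ u v → ∃ λ m → Walk G u v m

IsDist : {n : ℕ} → Graph n → (Fin n → Fin n → ℕ) → Set
IsDist G d = ∀ u v → Walk G u v (d u v) × (∀ m → Walk G u v m → d u v ≤ m)

count : {n : ℕ} → (Fin n → Bool) → ℕ
count {n} p = sum (map (λ v → if p v then 1 else 0) (allFin n))

degree : {n : ℕ} → Graph n → Fin n → ℕ
degree G u = count (adj G u)

MaxDegree : {n : ℕ} → Graph n → ℕ → Set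
MaxDegree G Δ = (∀ u → degree G u ≤ Δ) × ∃ λ u → degree G u ≡ Δ

-- u, v lie in the same part at layer j (w.r.t. root s, distance d):
-- both in L_j and joined by a walk in G ∖ L_{≤ j-1}.
SamePart : {n : ℕ} → Graph n → (Fin n → Fin n → ℕ) → Fin n → ℕ → Fin n → Fin n → Set
SamePart G d s j u v =
  d s u ≡ j × d s v ≡ j × ∃ λ m → WalkIn G (λ w → j ≤ d s w) u v m

-- ℓ ≥ ℓ(𝒯): every two vertices of a common part are at distance ≤ ℓ.
LengthBound : {n : ℕ} → Graph n → (Fin n → Fin n → ℕ) → Fin n → ℕ → Set
LengthBound G d s ℓ = ∀ j u v → SamePart G d s j u v → d u v ≤ ℓ

layerSize : {n : ℕ} → (Fin n → Fin n → ℕ) → Fin n → ℕ → ℕ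
layerSize {n} d s i = count (λ v → Data.Nat._≡ᵇ_ (d s v) i)

-- Adaptive distance-query algorithms (decision trees) on vertex set Fin n.
data QueryAlg (n : ℕ) (A : Set) : Set where
  ret : A → QueryAlg n A
  ask : Fin n → Fin n → (ℕ → QueryAlg n A) → QueryAlg n A

run : {n : ℕ} {A : Set} → QueryAlg n A → (Fin n → Fin n → ℕ) → A
run (ret a) o = a
run (ask u v k) o = run (k (o u v)) o

queries : {n : ℕ} {A : Set} → QueryAlg n A → (Fin n → Fin n → ℕ) → ℕ
queries (ret a) o = 0
queries (ask u v k) o = suc (queries (k (o u v)) o)

-- Adjacency of the induced subgraph G[L_{≤ j-1}] = G_j.
inducedBelow : {n : ℕ} → Graph n → (Fin n → Fin n → ℕ) → Fin n → ℕ → Fin n → Fin n → Bool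
inducedBelow G d s j u v = adj G u v ∧ (d s u <ᵇ j) ∧ (d s v <ᵇ j)

-- Input of the algorithm: n, Δ, ℓ, k, s, the layers (as the function v ↦ d(s,v)),
-- G_i (as an adjacency function), 𝒯_k (as the same-part relation on layers < k;
-- tree edges are then read off from G_i).  Output: adjacency function of G_{i+1}.
Algorithm : Set
Algorithm = (n Δ ℓ k : ℕ) → (s : Fin n) → (layer : Fin n → ℕ)
          → (Gi : Fin n → Fin n → Bool) → (part : Fin n → Fin n → Bool)
          → QueryAlg n (Fin n → Fin n → Bool)

{-# OPTIONS --safe #-}
module Submission where

-- For u ∈ Lᵢ let a(u) be an ancestor of u in the last layer j = k − 1 of 𝒯ₖ, i.e. a vertex of
-- that layer on a shortest s–u path.  If w ∈ Lᵢ₋₁ ∪ Lᵢ is a neighbour of u and b is a layer-j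
-- ancestor of w, the walk a(u) ⇝ u — w ⇝ b stays in layers ≥ j, so b lies in the part of a(u)
-- and d(a(u), w) ≤ ℓ + (i − j) ≤ 2ℓ + 3.  Querying d(u, w) for all such candidates w, which lie
-- in a ball of at most (Δ + 1)^(2ℓ+3) ≤ Δ^(4ℓ+8) vertices, reveals the edges of Gᵢ₊₁ at u.
-- The ancestor a(u) is found by binary search in the BFS DAG of Gᵢ: descend along heavy
-- children (those below which lie more than half of the remaining layer-j candidates) and test
-- the at most Δ children at the end of this heavy path for lying on a shortest s–u path, i.e.
-- d(y, u) + d(s, y) = i.  Either outcome discards at least half of the candidates, so
-- ⌈log₂ n⌉ rounds of at most Δ queries suffice.

open import Defs hiding (sym)
open import Data.Bool using (Bool; true; false; T; _∧_; _∨_; not; if_then_else_)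
open import Data.Bool.ListAction using (any)
open import Data.Bool.Properties using (T-≡; ⇔→≡; ∧-conicalˡ; ∧-conicalʳ; ∨-zeroʳ; ∧-identityʳ)
open import Data.Empty using (⊥-elim)
open import Data.Fin using (Fin; zero; suc; _≟_)
open import Data.Fin.Properties using () renaming (suc-injective to Fin-suc-injective)
open import Data.List using (List; []; _∷_; map; allFin; length; filterᵇ)
open import Data.List.Membership.Propositional using (_∈_; find; lose)
open import Data.List.Membership.Propositional.Properties using (∈-allFin; ∈-filter⁺; ∈-filter⁻)
open import Data.List.Properties using (map-tabulate; length-tabulate)
open import Data.List.Relation.Unary.Any using (here; there; any?)
open import Data.List.Relation.Unary.Any.Properties using (any⁺; any⁻)
open import Data.Maybe using (Maybe; just; nothing)
open import Data.Nat using (ℕ; zero; suc; _+_; _*_; _∸_; _^_; _≤_; _<_; z≤n; s≤s; _≡ᵇ_; _<ᵇ_; _≤ᵇ_; ⌈_/2⌉; ⌊_/2⌋)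
open import Data.Nat.Induction using (<-rec)
open import Data.Nat.ListAction using (sum)
open import Data.Nat.Logarithm using (⌈log₂_⌉; ⌈log₂⌉-mono-≤; ⌈log₂⌈n/2⌉⌉≡⌈log₂n⌉∸1)
open import Data.Nat.Properties hiding (_≟_)
open import Algebra.Properties.CommutativeSemigroup +-commutativeSemigroup using () renaming (interchange to +-interchange)
open import Data.Nat.Tactic.RingSolver using (solve-∀)
open import Data.Product using (Σ; ∃; _×_; _,_; proj₁; proj₂)
open import Data.Sum using (_⊎_; inj₁; inj₂)
open import Data.Unit using (tt)
open import Data.Vec.Functional using (updateAt)
open import Data.Vec.Functional.Properties using (updateAt-updates; updateAt-minimal)
open import Function using (_∘_; const)
open import Function.Bundles using (_⇔_; Equivalence; mk⇔)
open import Relation.Binary.PropositionalEquality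
open import Relation.Nullary using (¬_; Dec; yes; no; does)
open import Relation.Nullary.Decidable using (T?)

≡true⇒T : ∀ {b} → b ≡ true → T b
≡true⇒T = Equivalence.from T-≡

T⇒≡true : ∀ {b} → T b → b ≡ true
T⇒≡true = Equivalence.to T-≡

≡ᵇ≡true⇒≡ : ∀ {m n} → (m ≡ᵇ n) ≡ true → m ≡ n
≡ᵇ≡true⇒≡ {m} {n} = ≡ᵇ⇒≡ m n ∘ ≡true⇒T

≡⇒≡ᵇ≡true : ∀ {m n} → m ≡ n → (m ≡ᵇ n) ≡ true
≡⇒≡ᵇ≡true {m} {n} = T⇒≡true ∘ ≡⇒≡ᵇ m n

≡ᵇ≡false⇒≢ : ∀ {m n} → (m ≡ᵇ n) ≡ false → m ≢ n
≡ᵇ≡false⇒≢ e m≡n with () ← trans (sym e) (≡⇒≡ᵇ≡true m≡n)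

<ᵇ≡true⇒< : ∀ {m n} → (m <ᵇ n) ≡ true → m < n
<ᵇ≡true⇒< {m} {n} = <ᵇ⇒< m n ∘ ≡true⇒T

<⇒<ᵇ≡true : ∀ {m n} → m < n → (m <ᵇ n) ≡ true
<⇒<ᵇ≡true = T⇒≡true ∘ <⇒<ᵇ

≤ᵇ≡true⇒≤ : ∀ {m n} → (m ≤ᵇ n) ≡ true → m ≤ n
≤ᵇ≡true⇒≤ {m} {n} = ≤ᵇ⇒≤ m n ∘ ≡true⇒T

≤⇒≤ᵇ≡true : ∀ {m n} → m ≤ n → (m ≤ᵇ n) ≡ true
≤⇒≤ᵇ≡true = T⇒≡true ∘ ≤⇒≤ᵇ

≤ᵇ≡false⇒≰ : ∀ {m n} → (m ≤ᵇ n) ≡ false → ¬ m ≤ n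
≤ᵇ≡false⇒≰ e m≤n with () ← trans (sym e) (≤⇒≤ᵇ≡true m≤n)

<ᵇ-suc : ∀ m n → m ≢ n → (m <ᵇ n) ≡ (m <ᵇ suc n)
<ᵇ-suc zero    zero    m≢n = ⊥-elim (m≢n refl)
<ᵇ-suc zero    (suc n) _   = refl
<ᵇ-suc (suc m) zero    _   = refl
<ᵇ-suc (suc m) (suc n) m≢n = <ᵇ-suc m n (m≢n ∘ cong suc)

∨≡true⇒⊎ : ∀ {a b} → (a ∨ b) ≡ true → a ≡ true ⊎ b ≡ true
∨≡true⇒⊎ {true}  _ = inj₁ refl
∨≡true⇒⊎ {false} e = inj₂ e

module _ {A : Set} (p : A → Bool) where

  any-intro : ∀ {x} xs → x ∈ xs → p x ≡ true → any p xs ≡ true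
  any-intro xs x∈xs px = T⇒≡true (any⁺ p (lose x∈xs (≡true⇒T px)))

  any-elim : ∀ xs → any p xs ≡ true → ∃ λ x → x ∈ xs × p x ≡ true
  any-elim xs e with x , x∈xs , px ← find (any⁻ p xs (≡true⇒T e)) = x , x∈xs , T⇒≡true px

  ∈-filterᵇ⁺ : ∀ {x} xs → x ∈ xs → p x ≡ true → x ∈ filterᵇ p xs
  ∈-filterᵇ⁺ xs x∈xs px = ∈-filter⁺ (T? ∘ p) x∈xs (≡true⇒T px)

  ∈-filterᵇ⁻ : ∀ {x} xs → x ∈ filterᵇ p xs → p x ≡ true
  ∈-filterᵇ⁻ xs x∈ = T⇒≡true (proj₂ (∈-filter⁻ (T? ∘ p) {xs = xs} x∈))

-- Counting

countIn : {A : Set} → (A → Bool) → List A → ℕ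
countIn p xs = sum (map (λ x → if p x then 1 else 0) xs)

module _ {A : Set} where

  countIn-mono : {p q : A → Bool} → (∀ x → p x ≡ true → q x ≡ true) → ∀ xs → countIn p xs ≤ countIn q xs
  countIn-mono p⊆q [] = z≤n
  countIn-mono {p} {q} p⊆q (x ∷ xs) with p x in px | q x in qx
  ... | true  | true  = s≤s (countIn-mono p⊆q xs)
  ... | true  | false with () ← trans (sym (p⊆q x px)) qx
  ... | false | true  = m≤n⇒m≤1+n (countIn-mono p⊆q xs)
  ... | false | false = countIn-mono p⊆q xs

  countIn-∨ : (p q : A → Bool) → ∀ xs → countIn (λ x → p x ∨ q x) xs ≤ countIn p xs + countIn q xs
  countIn-∨ p q [] = z≤n
  countIn-∨ p q (x ∷ xs) with p x | q x
  ... | true  | true  = s≤s (≤-trans (countIn-∨ p q xs) (+-monoʳ-≤ (countIn p xs) (n≤1+n _)))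
  ... | true  | false = s≤s (countIn-∨ p q xs)
  ... | false | true  = ≤-trans (s≤s (countIn-∨ p q xs)) (≤-reflexive (sym (+-suc _ _)))
  ... | false | false = countIn-∨ p q xs

  countIn-split : (p q : A → Bool) → ∀ xs →
                  countIn p xs ≡ countIn (λ x → p x ∧ q x) xs + countIn (λ x → p x ∧ not (q x)) xs
  countIn-split p q [] = refl
  countIn-split p q (x ∷ xs) with p x | q x
  ... | true  | true  = cong suc (countIn-split p q xs)
  ... | true  | false = trans (cong suc (countIn-split p q xs)) (sym (+-suc _ _))
  ... | false | _     = countIn-split p q xs

  countIn≤length : (p : A → Bool) → ∀ xs → countIn p xs ≤ length xs
  countIn≤length p [] = z≤n
  countIn≤length p (x ∷ xs) with p x
  ... | true  = s≤s (countIn≤length p xs)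
  ... | false = m≤n⇒m≤1+n (countIn≤length p xs)

  countIn-none : (p : A → Bool) → (∀ x → p x ≡ false) → ∀ xs → countIn p xs ≡ 0
  countIn-none p none [] = refl
  countIn-none p none (x ∷ xs) rewrite none x = countIn-none p none xs

  countIn-≥1 : (p : A → Bool) → ∀ {x} xs → x ∈ xs → p x ≡ true → 1 ≤ countIn p xs
  countIn-≥1 p (y ∷ xs) (here refl) px rewrite px = s≤s z≤n
  countIn-≥1 p (y ∷ xs) (there x∈xs) px with p y
  ... | true  = s≤s z≤n
  ... | false = countIn-≥1 p xs x∈xs px

  countIn-≥2 : (p : A → Bool) → ∀ {x y} xs → x ∈ xs → y ∈ xs → x ≢ y → p x ≡ true → p y ≡ true →
               2 ≤ countIn p xs
  countIn-≥2 p (z ∷ xs) (here refl) (here refl) x≢y px py = ⊥-elim (x≢y refl)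
  countIn-≥2 p (z ∷ xs) (here refl) (there y∈xs) x≢y px py rewrite px = s≤s (countIn-≥1 p xs y∈xs py)
  countIn-≥2 p (z ∷ xs) (there x∈xs) (here refl) x≢y px py rewrite py = s≤s (countIn-≥1 p xs x∈xs px)
  countIn-≥2 p (z ∷ xs) (there x∈xs) (there y∈xs) x≢y px py with p z
  ... | true  = m≤n⇒m≤1+n (countIn-≥2 p xs x∈xs y∈xs x≢y px py)
  ... | false = countIn-≥2 p xs x∈xs y∈xs x≢y px py

  countIn-removeHeavy : (p q : A → Bool) → ∀ xs → countIn p xs < 2 * countIn (λ x → p x ∧ q x) xs →
                        2 * countIn (λ x → p x ∧ not (q x)) xs ≤ countIn p xs
  countIn-removeHeavy p q xs heavy = begin
    b + (b + 0)  ≤⟨ +-monoˡ-≤ (b + 0) (<⇒≤ b<a) ⟩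
    a + (b + 0)  ≡⟨ cong (a +_) (+-identityʳ b) ⟩
    a + b        ≡⟨ sym split ⟩
    countIn p xs ∎
    where
      open ≤-Reasoning
      a = countIn (λ x → p x ∧ q x) xs
      b = countIn (λ x → p x ∧ not (q x)) xs
      split : countIn p xs ≡ a + b
      split = countIn-split p q xs
      b<a : b < a
      b<a = +-cancelˡ-< a b a (begin-strict
        a + b        ≡⟨ sym split ⟩
        countIn p xs <⟨ heavy ⟩
        a + (a + 0)  ≡⟨ cong (a +_) (+-identityʳ a) ⟩
        a + a        ∎)

  length-filterᵇ : (p : A → Bool) → ∀ xs → length (filterᵇ p xs) ≡ countIn p xs
  length-filterᵇ p [] = refl
  length-filterᵇ p (x ∷ xs) with p x
  ... | true  = cong suc (length-filterᵇ p xs)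
  ... | false = length-filterᵇ p xs

  sum-map-≤ : (f : A → ℕ) (B : ℕ) → ∀ xs → (∀ x → x ∈ xs → f x ≤ B) → sum (map f xs) ≤ length xs * B
  sum-map-≤ f B [] f≤B = z≤n
  sum-map-≤ f B (x ∷ xs) f≤B = +-mono-≤ (f≤B x (here refl)) (sum-map-≤ f B xs (λ y → f≤B y ∘ there))

  sum-map-+ : (f g : A → ℕ) → ∀ xs → sum (map (λ x → f x + g x) xs) ≡ sum (map f xs) + sum (map g xs)
  sum-map-+ f g [] = refl
  sum-map-+ f g (x ∷ xs) = trans (cong (f x + g x +_) (sum-map-+ f g xs)) (+-interchange (f x) (g x) _ _)

count-suc : ∀ {n} (p : Fin (suc n) → Bool) → count p ≡ (if p zero then 1 else 0) + count (p ∘ suc)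
count-suc {n} p = cong ((if p zero then 1 else 0) +_) (cong sum
  (trans (map-tabulate suc indicator) (sym (map-tabulate (λ x → x) (indicator ∘ suc)))))
  where indicator = λ x → if p x then 1 else 0

count-≤1 : ∀ {n} (p : Fin n → Bool) → (∀ x y → p x ≡ true → p y ≡ true → x ≡ y) → count p ≤ 1
count-≤1 {zero} p unique = z≤n
count-≤1 {suc n} p unique rewrite count-suc p with p zero in p0
... | true  = ≤-reflexive (cong suc (countIn-none (p ∘ suc) p∘suc-false (allFin n)))
  where
    p∘suc-false : ∀ x → p (suc x) ≡ false
    p∘suc-false x with p (suc x) in p1
    ... | false = refl
    ... | true with () ← unique zero (suc x) p0 p1
... | false = count-≤1 (p ∘ suc) (λ x y px py → Fin-suc-injective (unique (suc x) (suc y) px py))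

count≤1⇒≡ : ∀ {n} (p : Fin n → Bool) → count p ≤ 1 → ∀ {x y} → p x ≡ true → p y ≡ true → x ≡ y
count≤1⇒≡ p count≤1 {x} {y} px py with x ≟ y
... | yes x≡y = x≡y
... | no  x≢y = ⊥-elim (<⇒≱ (countIn-≥2 p (allFin _) (∈-allFin x) (∈-allFin y) x≢y px py) count≤1)

-- Arithmetic

n≤2^⌈log₂n⌉ : ∀ n → n ≤ 2 ^ ⌈log₂ n ⌉
n≤2^⌈log₂n⌉ = <-rec (λ n → n ≤ 2 ^ ⌈log₂ n ⌉) bound
  where
    bound : ∀ n → (∀ {m} → m < n → m ≤ 2 ^ ⌈log₂ m ⌉) → n ≤ 2 ^ ⌈log₂ n ⌉
    bound zero          _  = z≤n
    bound (suc zero)    _  = s≤s z≤n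
    bound N@(suc (suc m)) ih = begin
      N                                    ≡⟨ sym (⌊n/2⌋+⌈n/2⌉≡n N) ⟩
      ⌊ N /2⌋ + ⌈ N /2⌉                    ≤⟨ +-monoˡ-≤ ⌈ N /2⌉ (⌊n/2⌋≤⌈n/2⌉ N) ⟩
      ⌈ N /2⌉ + ⌈ N /2⌉                    ≤⟨ +-mono-≤ half≤ half≤ ⟩
      P + P                                ≡⟨ cong (P +_) (sym (+-identityʳ P)) ⟩
      2 * P                                ≡⟨ cong (2 ^_) (trans (cong suc (⌈log₂⌈n/2⌉⌉≡⌈log₂n⌉∸1 N)) (m+[n∸m]≡n 1≤⌈log₂N⌉)) ⟩
      2 ^ ⌈log₂ N ⌉                        ∎
      where
        open ≤-Reasoning
        P = 2 ^ ⌈log₂ ⌈ N /2⌉ ⌉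
        half≤ : ⌈ N /2⌉ ≤ P
        half≤ = ih (⌈n/2⌉<n m)
        1≤⌈log₂N⌉ : 1 ≤ ⌈log₂ N ⌉
        1≤⌈log₂N⌉ = ⌈log₂⌉-mono-≤ {2} {N} (s≤s (s≤s z≤n))

[k+ℓ+2]∸[k∸1]≤ℓ+3 : ∀ k ℓ → k + ℓ + 2 ∸ (k ∸ 1) ≤ ℓ + 3
[k+ℓ+2]∸[k∸1]≤ℓ+3 zero     ℓ = +-monoʳ-≤ ℓ (n≤1+n 2)
[k+ℓ+2]∸[k∸1]≤ℓ+3 (suc k′) ℓ = ≤-reflexive (begin
  suc k′ + ℓ + 2 ∸ k′     ≡⟨ cong (_∸ k′) (+-assoc (suc k′) ℓ 2) ⟩
  suc (k′ + (ℓ + 2)) ∸ k′ ≡⟨ cong (_∸ k′) (sym (+-suc k′ (ℓ + 2))) ⟩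
  k′ + suc (ℓ + 2) ∸ k′   ≡⟨ m+n∸m≡n k′ (suc (ℓ + 2)) ⟩
  suc (ℓ + 2)             ≡⟨ sym (+-suc ℓ 2) ⟩
  ℓ + 3                   ∎)
  where open ≡-Reasoning

m*n≤n^e*m : ∀ m n e → 1 ≤ e → m * n ≤ n ^ e * m
m*n≤n^e*m m zero        e 1≤e = ≤-trans (≤-reflexive (*-zeroʳ m)) z≤n
m*n≤n^e*m m n@(suc _)   e 1≤e = begin
  m * n      ≡⟨ *-comm m n ⟩
  n * m      ≤⟨ *-monoˡ-≤ m (≤-trans (≤-reflexive (sym (*-identityʳ n))) (^-monoʳ-≤ n 1≤e)) ⟩
  n ^ e * m  ∎
  where open ≤-Reasoning

[1+m]^e≤m^[2*e] : ∀ m e → 2 ≤ m → suc m ^ e ≤ m ^ (2 * e)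
[1+m]^e≤m^[2*e] m e 2≤m = begin
  suc m ^ e      ≤⟨ ^-monoˡ-≤ e suc-m≤m*m ⟩
  (m * m) ^ e    ≡⟨ cong (λ x → (m * x) ^ e) (sym (*-identityʳ m)) ⟩
  (m ^ 2) ^ e    ≡⟨ ^-*-assoc m 2 e ⟩
  m ^ (2 * e)    ∎
  where
    open ≤-Reasoning
    suc-m≤m*m : suc m ≤ m * m
    suc-m≤m*m = begin
      1 + m    ≤⟨ +-monoˡ-≤ m (≤-trans (s≤s z≤n) 2≤m) ⟩
      m + m    ≡⟨ cong (m +_) (sym (+-identityʳ m)) ⟩
      2 * m    ≤⟨ *-monoˡ-≤ m 2≤m ⟩
      m * m    ∎

[1+Δ]^[ℓ+[ℓ+3]]≤Δ^[4ℓ+8] : ∀ Δ ℓ → 2 ≤ Δ → suc Δ ^ (ℓ + (ℓ + 3)) ≤ Δ ^ (4 * ℓ + 8)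
[1+Δ]^[ℓ+[ℓ+3]]≤Δ^[4ℓ+8] Δ@(suc _) ℓ 2≤Δ = ≤-trans ([1+m]^e≤m^[2*e] Δ (ℓ + (ℓ + 3)) 2≤Δ)
  (^-monoʳ-≤ Δ (≤-trans (m≤m+n (2 * (ℓ + (ℓ + 3))) 2) (≤-reflexive (exponent ℓ))))
  where
    exponent : ∀ ℓ → 2 * (ℓ + (ℓ + 3)) + 2 ≡ 4 * ℓ + 8
    exponent = solve-∀

-- Query algorithms

module _ {n : ℕ} {A B : Set} where

  _>>=_ : QueryAlg n A → (A → QueryAlg n B) → QueryAlg n B
  ret a     >>= f = f a
  ask u v k >>= f = ask u v (λ r → k r >>= f)

  run->>= : (m : QueryAlg n A) (f : A → QueryAlg n B) (o : Fin n → Fin n → ℕ) → run (m >>= f) o ≡ run (f (run m o)) o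
  run->>= (ret a)     f o = refl
  run->>= (ask u v k) f o = run->>= (k (o u v)) f o

  queries->>= : (m : QueryAlg n A) (f : A → QueryAlg n B) (o : Fin n → Fin n → ℕ) →
                queries (m >>= f) o ≡ queries m o + queries (f (run m o)) o
  queries->>= (ret a)     f o = refl
  queries->>= (ask u v k) f o = cong suc (queries->>= (k (o u v)) f o)

module _ {n : ℕ} {B : Set} (b : B) (h : Fin n → QueryAlg n B) where

  forEach : List (Fin n) → QueryAlg n (Fin n → B)
  forEach []       = ret (const b)
  forEach (v ∷ vs) = h v >>= λ r → forEach vs >>= λ g → ret (updateAt g v (const r))

  module _ (o : Fin n → Fin n → ℕ) where

    run-forEach-∷ : ∀ v vs → run (forEach (v ∷ vs)) o ≡ updateAt (run (forEach vs) o) v (const (run (h v) o))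
    run-forEach-∷ v vs = trans (run->>= (h v) _ o) (run->>= (forEach vs) _ o)

    run-forEach-∈ : ∀ {v} vs → v ∈ vs → run (forEach vs) o v ≡ run (h v) o
    run-forEach-∈ {v} (x ∷ xs) v∈ with v ≟ x | v∈
    ... | yes refl | _           = trans (cong-app (run-forEach-∷ x xs) v) (updateAt-updates v _)
    ... | no  v≢x  | here v≡x    = ⊥-elim (v≢x v≡x)
    ... | no  v≢x  | there v∈xs  =
      trans (cong-app (run-forEach-∷ x xs) v) (trans (updateAt-minimal v x _ v≢x) (run-forEach-∈ xs v∈xs))

    run-forEach-∉ : ∀ {v} vs → ¬ v ∈ vs → run (forEach vs) o v ≡ b
    run-forEach-∉ []       v∉ = refl
    run-forEach-∉ {v} (x ∷ xs) v∉ =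
      trans (cong-app (run-forEach-∷ x xs) v)
            (trans (updateAt-minimal v x _ (v∉ ∘ here)) (run-forEach-∉ xs (v∉ ∘ there)))

    queries-forEach : ∀ vs → queries (forEach vs) o ≡ sum (map (λ v → queries (h v) o) vs)
    queries-forEach []       = refl
    queries-forEach (v ∷ vs) = begin
      queries (forEach (v ∷ vs)) o                              ≡⟨ queries->>= (h v) _ o ⟩
      queries (h v) o + queries (forEach vs >>= _) o            ≡⟨ cong (queries (h v) o +_) (queries->>= (forEach vs) _ o) ⟩
      queries (h v) o + (queries (forEach vs) o + 0)            ≡⟨ cong (queries (h v) o +_) (+-identityʳ _) ⟩
      queries (h v) o + queries (forEach vs) o                  ≡⟨ cong (queries (h v) o +_) (queries-forEach vs) ⟩
      queries (h v) o + sum (map (λ v → queries (h v) o) vs)    ∎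
      where open ≡-Reasoning

-- Walks, distances and BFS layers

module Walks {n : ℕ} (G : Graph n) where

  _++ʷ_ : ∀ {P a b c m m′} → WalkIn G P a b m → WalkIn G P b c m′ → WalkIn G P a c (m + m′)
  here _       ++ʷ w = w
  step p e w′  ++ʷ w = step p e (w′ ++ʷ w)

  snocʷ : ∀ {P a b c m} → WalkIn G P a b m → adj G b c ≡ true → P c → WalkIn G P a c (suc m)
  snocʷ (here pb)    e pc = step pb e (here pc)
  snocʷ (step p e w) e′ pc = step p e (snocʷ w e′ pc)

  reverseʷ : ∀ {P a b m} → WalkIn G P a b m → WalkIn G P b a m
  reverseʷ (here p) = here p
  reverseʷ {a = a} (step {w = w} p e r) = snocʷ (reverseʷ r) (trans (Graph.sym G w a) e) p

  mapʷ : ∀ {P Q : Fin n → Set} {a b m} → (∀ {x} → P x → Q x) → WalkIn G P a b m → WalkIn G Q a b m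
  mapʷ f (here p)     = here (f p)
  mapʷ f (step p e w) = step (f p) e (mapʷ f w)

module Distance {n : ℕ} (G : Graph n) (d : Fin n → Fin n → ℕ) (isDist : IsDist G d) where
  open Walks G

  geodesic : ∀ u v → Walk G u v (d u v)
  geodesic u v = proj₁ (isDist u v)

  d≤length : ∀ {u v m} → Walk G u v m → d u v ≤ m
  d≤length {u} {v} {m} = proj₂ (isDist u v) m

  d-triangle : ∀ a b c → d a c ≤ d a b + d b c
  d-triangle a b c = d≤length (geodesic a b ++ʷ geodesic b c)

  d-sym : ∀ u v → d u v ≡ d v u
  d-sym u v = ≤-antisym (d≤length (reverseʷ (geodesic v u))) (d≤length (reverseʷ (geodesic u v)))

  d≡0⇒≡ : ∀ {u v} → d u v ≡ 0 → u ≡ v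
  d≡0⇒≡ {u} {v} = walk≡0⇒≡ (geodesic u v)
    where
      walk≡0⇒≡ : ∀ {m} → Walk G u v m → m ≡ 0 → u ≡ v
      walk≡0⇒≡ (here _) _ = refl

  d-refl : ∀ u → d u u ≡ 0
  d-refl u = n≤0⇒n≡0 (d≤length (here tt))

  adj⇒d≤1 : ∀ {u v} → adj G u v ≡ true → d u v ≤ 1
  adj⇒d≤1 e = d≤length (step tt e (here tt))

  adj⇒d≡1 : ∀ {u v} → adj G u v ≡ true → d u v ≡ 1
  adj⇒d≡1 {u} {v} e with d u v in duv | adj⇒d≤1 e
  ... | zero     | _ with refl ← d≡0⇒≡ duv with () ← trans (sym (irrefl G u)) e
  ... | suc zero | _ = refl
  ... | suc (suc _) | s≤s ()

  d≡1⇒adj : ∀ {u v} → d u v ≡ 1 → adj G u v ≡ true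
  d≡1⇒adj {u} {v} = walk≡1⇒adj (geodesic u v)
    where
      walk≡1⇒adj : ∀ {m} → Walk G u v m → m ≡ 1 → adj G u v ≡ true
      walk≡1⇒adj (step _ e (here _)) _ = e

  d≡ᵇ1≡adj : ∀ u v → (d u v ≡ᵇ 1) ≡ adj G u v
  d≡ᵇ1≡adj u v = ⇔→≡ {z = true} (mk⇔ (d≡1⇒adj ∘ ≡ᵇ≡true⇒≡) (≡⇒≡ᵇ≡true ∘ adj⇒d≡1))

  geodesic-step : ∀ y t m → d y t ≡ suc m → ∃ λ z → adj G y z ≡ true × d z t ≡ m
  geodesic-step y t m dyt = first-step (geodesic y t) dyt
    where
      first-step : ∀ {m′} → Walk G y t m′ → m′ ≡ suc m → ∃ λ z → adj G y z ≡ true × d z t ≡ m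
      first-step (step {w = z} _ e w) refl = z , e , ≤-antisym (d≤length w) (≤-pred (begin
        suc m          ≡⟨ sym dyt ⟩
        d y t          ≤⟨ d-triangle y z t ⟩
        d y z + d z t  ≤⟨ +-monoˡ-≤ (d z t) (adj⇒d≤1 e) ⟩
        suc (d z t)    ∎))
        where open ≤-Reasoning

  module Layers (s : Fin n) where

    layer : Fin n → ℕ
    layer = d s

    AncestorOf : Fin n → Fin n → Set
    AncestorOf t y = d y t + layer y ≡ layer t

    layer-root : layer s ≡ 0
    layer-root = d-refl s

    root-ancestor : ∀ t → AncestorOf t s
    root-ancestor t rewrite layer-root = +-identityʳ (d s t)

    adj⇒layer≤suc : ∀ {u v} → adj G u v ≡ true → layer v ≤ suc (layer u)
    adj⇒layer≤suc {u} {v} e = begin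
      layer v          ≤⟨ d-triangle s u v ⟩
      layer u + d u v  ≤⟨ +-monoʳ-≤ (layer u) (adj⇒d≤1 e) ⟩
      layer u + 1      ≡⟨ +-comm (layer u) 1 ⟩
      suc (layer u)    ∎
      where open ≤-Reasoning

    ancestor-step : ∀ {t y} → AncestorOf t y → layer y < layer t →
                    ∃ λ z → adj G y z ≡ true × layer z ≡ suc (layer y) × AncestorOf t z
    ancestor-step {t} {y} anc y<t with d y t in dyt
    ... | zero  = ⊥-elim (<-irrefl anc y<t)
    ... | suc m with geodesic-step y t m dyt
    ... | z , e , dzt = z , e , layer-z , trans (cong₂ _+_ dzt layer-z) (trans (+-suc m (layer y)) anc)
      where
        layer-z : layer z ≡ suc (layer y)
        layer-z = ≤-antisym (adj⇒layer≤suc e) (+-cancelˡ-≤ m _ _ (begin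
          m + suc (layer y)  ≡⟨ +-suc m (layer y) ⟩
          suc m + layer y    ≡⟨ anc ⟩
          layer t            ≤⟨ d-triangle s z t ⟩
          layer z + d z t    ≡⟨ trans (cong (layer z +_) dzt) (+-comm (layer z) m) ⟩
          m + layer z        ∎))
          where open ≤-Reasoning

    ancestor-walk : ∀ m {t y} → d y t ≡ m → AncestorOf t y → WalkIn G (λ w → layer y ≤ layer w) y t m
    ancestor-walk zero    dyt anc with refl ← d≡0⇒≡ dyt = here ≤-refl
    ancestor-walk (suc m) {t} {y} dyt anc with ancestor-step anc y<t
      where
        y<t : layer y < layer t
        y<t = ≤-trans (m<n+m (layer y) {suc m} (s≤s z≤n)) (≤-reflexive (trans (cong (_+ layer y) (sym dyt)) anc))
    ... | z , e , layer-z , anc-z = step ≤-refl e (mapʷ (≤-trans y≤z) (ancestor-walk m dzt anc-z))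
      where
        y≤z : layer y ≤ layer z
        y≤z = ≤-trans (n≤1+n (layer y)) (≤-reflexive (sym layer-z))
        dzt : d z t ≡ m
        dzt = suc-injective (+-cancelʳ-≡ (layer y) _ _ (begin
          suc (d z t) + layer y  ≡⟨ sym (+-suc (d z t) (layer y)) ⟩
          d z t + suc (layer y)  ≡⟨ cong (d z t +_) (sym layer-z) ⟩
          d z t + layer z        ≡⟨ anc-z ⟩
          layer t                ≡⟨ sym anc ⟩
          d y t + layer y        ≡⟨ cong (_+ layer y) dyt ⟩
          suc m + layer y        ∎))
          where open ≡-Reasoning

    ancestor-sameLayer⇒≡ : ∀ {t w} → AncestorOf t w → layer w ≡ layer t → w ≡ t
    ancestor-sameLayer⇒≡ {t} {w} anc eq = d≡0⇒≡ (+-cancelʳ-≡ (layer w) _ _ (trans anc (sym eq)))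

  module BoundedDegree (Δ : ℕ) (degree≤Δ : ∀ u → degree G u ≤ Δ) where

    ball : Fin n → ℕ → Fin n → Bool
    ball a r w = d a w ≤ᵇ r

    count-neighbours : (B : Fin n → Bool) → ∀ xs →
                       count (λ w → any (λ x → B x ∧ adj G x w) xs) ≤ Δ * countIn B xs
    count-neighbours B [] = ≤-trans (≤-reflexive (countIn-none _ (λ _ → refl) (allFin n))) z≤n
    count-neighbours B (x ∷ xs) with B x
    ... | true  = begin
      count (λ w → adj G x w ∨ any (λ y → B y ∧ adj G y w) xs)          ≤⟨ countIn-∨ (adj G x) _ (allFin n) ⟩
      degree G x + count (λ w → any (λ y → B y ∧ adj G y w) xs)         ≤⟨ +-mono-≤ (degree≤Δ x) (count-neighbours B xs) ⟩
      Δ + Δ * countIn B xs                                              ≡⟨ sym (*-suc Δ _) ⟩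
      Δ * suc (countIn B xs)                                            ∎
      where open ≤-Reasoning
    ... | false = count-neighbours B xs

    ball-suc : ∀ a r w → ball a (suc r) w ≡ true →
               (ball a r w ∨ any (λ x → ball a r x ∧ adj G x w) (allFin n)) ≡ true
    ball-suc a r w w∈ with d a w ≤ᵇ r in w∈ball
    ... | true  = refl
    ... | false with geodesic-step w a r dwa
      where
        dwa : d w a ≡ suc r
        dwa = trans (d-sym w a) (≤-antisym (≤ᵇ≡true⇒≤ w∈) (≰⇒> (≤ᵇ≡false⇒≰ w∈ball)))
    ... | z , e , dza = any-intro _ (allFin n) (∈-allFin z)
          (cong₂ _∧_ (≤⇒≤ᵇ≡true (≤-reflexive (trans (d-sym a z) dza))) (trans (Graph.sym G z w) e))

    count-ball : ∀ a r → count (ball a r) ≤ suc Δ ^ r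
    count-ball a zero = count-≤1 (ball a 0) (λ x y ax ay → trans (sym (centre ax)) (centre ay))
      where
        centre : ∀ {x} → ball a 0 x ≡ true → a ≡ x
        centre ax = d≡0⇒≡ (n≤0⇒n≡0 (≤ᵇ≡true⇒≤ ax))
    count-ball a (suc r) = begin
      count (ball a (suc r))                         ≤⟨ countIn-mono (ball-suc a r) (allFin n) ⟩
      count (λ w → ball a r w ∨ N w)                 ≤⟨ countIn-∨ _ _ (allFin n) ⟩
      count (ball a r) + count N                     ≤⟨ +-monoʳ-≤ (count (ball a r)) (count-neighbours (ball a r) (allFin n)) ⟩
      count (ball a r) + Δ * count (ball a r)        ≤⟨ *-monoʳ-≤ (suc Δ) (count-ball a r) ⟩
      suc Δ * suc Δ ^ r                              ∎
      where
        open ≤-Reasoning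
        N = λ w → any (λ x → ball a r x ∧ adj G x w) (allFin n)

    module _ (s : Fin n) where
      open Layers s

      2≤layer⇒2≤Δ : ∀ u → 2 ≤ layer u → 2 ≤ Δ
      2≤layer⇒2≤Δ u 2≤u
        with ancestor-step (root-ancestor u) (≤-trans (s≤s (≤-reflexive layer-root)) (≤-trans (s≤s z≤n) 2≤u))
      ... | z₁ , s~z₁ , layer-z₁ , anc₁
        with ancestor-step anc₁ (≤-trans (s≤s (≤-reflexive layer-z₁)) (≤-trans (s≤s (s≤s (≤-reflexive layer-root))) 2≤u))
      ... | z₂ , z₁~z₂ , layer-z₂ , _ =
        ≤-trans (countIn-≥2 (adj G z₁) (allFin n) (∈-allFin s) (∈-allFin z₂) s≢z₂ (trans (Graph.sym G z₁ s) s~z₁) z₁~z₂)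
                (degree≤Δ z₁)
        where
          s≢z₂ : s ≢ z₂
          s≢z₂ refl = 0≢1+n (trans (sym layer-root) (trans layer-z₂ (cong suc (trans layer-z₁ (cong suc layer-root)))))

-- The algorithm

module Algorithm (n ℓ k : ℕ) (s : Fin n) (layer : Fin n → ℕ) (Gᵢ part : Fin n → Fin n → Bool) where

  -- j is the last layer of 𝒯ₖ (for k = 0 the truncation makes it the root layer)
  i j : ℕ
  i = k + ℓ + 2
  j = k ∸ 1

  isChild : Fin n → Fin n → Bool
  isChild x y = Gᵢ x y ∧ (layer y ≡ᵇ suc (layer x))

  children : Fin n → List (Fin n)
  children x = filterᵇ (isChild x) (allFin n)

  descendant : ℕ → Fin n → Fin n → Bool
  descendant zero    x w = does (x ≟ w)
  descendant (suc f) x w = any (λ y → descendant f y w) (children x)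

  Heavy : (Fin n → Bool) → ℕ → Fin n → Set
  Heavy X f x = count X < 2 * count (λ w → X w ∧ descendant f x w)

  heavy? : ∀ X f x → Dec (Heavy X f x)
  heavy? X f x = count X <? 2 * count (λ w → X w ∧ descendant f x w)

  heavyPath : (Fin n → Bool) → ℕ → Fin n → ℕ × Fin n
  heavyPath X zero    x = zero , x
  heavyPath X (suc f) x with any? (heavy? X f) (children x)
  ... | yes heavyChild = heavyPath X f (proj₁ (find heavyChild))
  ... | no  _          = suc f , x

  State : Set
  State = Fin n × ℕ × (Fin n → Bool)

  module FindAncestor (u : Fin n) where

    firstAncestor : List (Fin n) → QueryAlg n (Maybe (Fin n))
    firstAncestor []       = ret nothing
    firstAncestor (y ∷ ys) = ask y u (λ r → if r + layer y ≡ᵇ i then ret (just y) else firstAncestor ys)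

    refine : State → ℕ → Fin n → Maybe (Fin n) → State
    refine (c , f , X) f′ x (just y) = y , f′ , λ w → X w ∧ descendant f′ y w
    refine (c , f , X) f′ x nothing  = c , f , λ w → X w ∧ not (descendant (suc f′) x w)

    roundAt : State → ℕ × Fin n → QueryAlg n State
    roundAt st (zero   , x) = ret st
    roundAt st (suc f′ , x) = firstAncestor (children x) >>= (ret ∘ refine st f′ x)

    round : State → QueryAlg n State
    round (c , f , X) = roundAt (c , f , X) (heavyPath X f c)

    pick : (Fin n → Bool) → Fin n
    pick X with any? (T? ∘ X) (allFin n)
    ... | yes w∈X = proj₁ (find w∈X)
    ... | no  _   = u

    -- the fallbacks `ret c` and `u` in pick are unreachable: ⌈log₂ n⌉ halvings leave exactly one candidate
    rounds : ℕ → State → QueryAlg n (Fin n)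
    rounds r (c , f , X) with count X ≤? 1
    rounds r       (c , f , X) | yes _ = ret (pick X)
    rounds zero    (c , f , X) | no  _ = ret c
    rounds (suc r) st          | no  _ = round st >>= rounds r

    findAncestor : QueryAlg n (Fin n)
    findAncestor = rounds ⌈log₂ n ⌉ (s , j , descendant j s)

  -- 𝒯₀ is empty, but then L₀ = {s} is a single part
  samePart : Fin n → Fin n → Bool
  samePart x y = if k ≡ᵇ 0 then true else part x y

  module _ (a : Fin n → Fin n) (u w : Fin n) where

    partCandidate anchorCandidate candidate : Bool
    partCandidate   = (layer w ≡ᵇ i ∸ 1)
                    ∧ any (λ b → (layer b ≡ᵇ j) ∧ (samePart (a u) b ∧ descendant (i ∸ 1 ∸ j) b w)) (allFin n)
    anchorCandidate = (layer w ≡ᵇ i) ∧ samePart (a u) (a w)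
    candidate       = partCandidate ∨ anchorCandidate

  layerᵢ : List (Fin n)
  layerᵢ = filterᵇ (λ v → layer v ≡ᵇ i) (allFin n)

  isEdge : Fin n → Fin n → QueryAlg n Bool
  isEdge u w = ask u w (λ r → ret (r ≡ᵇ 1))

  neighbours : (Fin n → Fin n) → Fin n → QueryAlg n (Fin n → Bool)
  neighbours a u = forEach false (isEdge u) (filterᵇ (candidate a u) (allFin n))

  extend : (Fin n → Fin n → Bool) → Fin n → Fin n → Bool
  extend g u v = if layer u ≡ᵇ i then g u v
                 else if layer v ≡ᵇ i then g v u
                 else Gᵢ u v

  anchors : QueryAlg n (Fin n → Fin n)
  anchors = forEach s FindAncestor.findAncestor layerᵢ

  neighbourhoods : (Fin n → Fin n) → QueryAlg n (Fin n → Fin n → Bool)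
  neighbourhoods a = forEach (λ _ → false) (neighbours a) layerᵢ

  algorithm : QueryAlg n (Fin n → Fin n → Bool)
  algorithm = anchors >>= λ a → neighbourhoods a >>= (ret ∘ extend)

-- Correctness and cost

module Correctness {n : ℕ} (G : Graph n) (d : Fin n → Fin n → ℕ) (Δ ℓ k : ℕ) (s : Fin n)
    (Gᵢ part : Fin n → Fin n → Bool)
    (isDist : IsDist G d) (maxDegree : MaxDegree G Δ) (lengthBound : LengthBound G d s ℓ)
    (Gᵢ-spec : ∀ u v → Gᵢ u v ≡ inducedBelow G d s (k + ℓ + 2) u v)
    (part-spec : ∀ j u v → j < k → d s u ≡ j → d s v ≡ j → (part u v ≡ true ⇔ SamePart G d s j u v))
    where
  open Walks G
  open Distance G d isDist
  open Layers s
  open BoundedDegree Δ (proj₁ maxDegree)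
  open Algorithm n ℓ k s layer Gᵢ part

  j<i : j < i
  j<i = ≤-trans (s≤s (≤-trans (m∸n≤m k 1) (m≤m+n k ℓ))) (m<m+n (k + ℓ) (s≤s z≤n))

  child⁻ : ∀ {x y} → y ∈ children x → adj G x y ≡ true × layer y ≡ suc (layer x) × layer y < i
  child⁻ {x} {y} y∈ = ∧-conicalˡ (adj G x y) _ inGᵢ
                     , ≡ᵇ≡true⇒≡ (∧-conicalʳ (Gᵢ x y) _ xy)
                     , <ᵇ≡true⇒< (∧-conicalʳ (layer x <ᵇ i) _ (∧-conicalʳ (adj G x y) _ inGᵢ))
    where
      xy : isChild x y ≡ true
      xy = ∈-filterᵇ⁻ (isChild x) (allFin n) y∈
      inGᵢ : (adj G x y ∧ ((layer x <ᵇ i) ∧ (layer y <ᵇ i))) ≡ true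
      inGᵢ = trans (sym (Gᵢ-spec x y)) (∧-conicalˡ (Gᵢ x y) _ xy)

  child⁺ : ∀ {x y} → adj G x y ≡ true → layer y ≡ suc (layer x) → layer y < i → y ∈ children x
  child⁺ {x} {y} e layer-y y<i = ∈-filterᵇ⁺ (isChild x) (allFin n) (∈-allFin y) (cong₂ _∧_ inGᵢ (≡⇒≡ᵇ≡true layer-y))
    where
      x<i : layer x < i
      x<i = ≤-trans (≤-reflexive (sym layer-y)) (<⇒≤ y<i)
      inGᵢ : Gᵢ x y ≡ true
      inGᵢ = trans (Gᵢ-spec x y) (cong₂ _∧_ e (cong₂ _∧_ (<⇒<ᵇ≡true x<i) (<⇒<ᵇ≡true y<i)))

  length-children≤Δ : ∀ x → length (children x) ≤ Δ
  length-children≤Δ x = begin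
    length (children x)   ≡⟨ length-filterᵇ (isChild x) (allFin n) ⟩
    count (isChild x)     ≤⟨ countIn-mono child⇒adj (allFin n) ⟩
    degree G x            ≤⟨ proj₁ maxDegree x ⟩
    Δ                     ∎
    where
      open ≤-Reasoning
      child⇒adj : ∀ y → isChild x y ≡ true → adj G x y ≡ true
      child⇒adj y xy = proj₁ (child⁻ (∈-filterᵇ⁺ (isChild x) (allFin n) (∈-allFin y) xy))

  descendant-zero⁻ : ∀ {x w} → descendant 0 x w ≡ true → x ≡ w
  descendant-zero⁻ {x} {w} e with x ≟ w
  ... | yes x≡w = x≡w

  descendant-refl : ∀ x → descendant 0 x x ≡ true
  descendant-refl x with x ≟ x
  ... | yes _   = refl
  ... | no  x≢x = ⊥-elim (x≢x refl)

  descendant-suc⁺ : ∀ {f x y w} → y ∈ children x → descendant f y w ≡ true → descendant (suc f) x w ≡ true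
  descendant-suc⁺ {f} {x} {y} {w} = any-intro (λ y → descendant f y w) (children x)

  descendant-suc⁻ : ∀ {f x w} → descendant (suc f) x w ≡ true → ∃ λ y → y ∈ children x × descendant f y w ≡ true
  descendant-suc⁻ {f} {x} {w} = any-elim (λ y → descendant f y w) (children x)

  descendant⇒walk : ∀ f x w → descendant f x w ≡ true → layer w ≡ layer x + f × Walk G x w f
  descendant⇒walk zero    x w e with refl ← descendant-zero⁻ {x} {w} e = sym (+-identityʳ _) , here tt
  descendant⇒walk (suc f) x w e with y , y∈ , e′ ← descendant-suc⁻ {f} {x} {w} e
                                  with layer-w , walk ← descendant⇒walk f y w e′
                                  with x~y , layer-y , _ ← child⁻ y∈ =
    trans layer-w (trans (cong (_+ f) layer-y) (sym (+-suc (layer x) f))) , step tt x~y walk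

  ancestor-up : ∀ {f y w t} → descendant f y w ≡ true → AncestorOf t w → AncestorOf t y
  ancestor-up {f} {y} {w} {t} e anc-w = ≤-antisym (begin
      d y t + layer y          ≤⟨ +-monoˡ-≤ (layer y) (d-triangle y w t) ⟩
      d y w + d w t + layer y  ≤⟨ +-monoˡ-≤ (layer y) (+-monoˡ-≤ (d w t) (d≤length walk)) ⟩
      f + d w t + layer y      ≡⟨ cong (_+ layer y) (+-comm f (d w t)) ⟩
      d w t + f + layer y      ≡⟨ +-assoc (d w t) f (layer y) ⟩
      d w t + (f + layer y)    ≡⟨ cong (d w t +_) (trans (+-comm f (layer y)) (sym layer-w)) ⟩
      d w t + layer w          ≡⟨ anc-w ⟩
      layer t                  ∎)
    (≤-trans (d-triangle s y t) (≤-reflexive (+-comm (layer y) (d y t))))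
    where
      open ≤-Reasoning
      layer-w = proj₁ (descendant⇒walk f y w e)
      walk = proj₂ (descendant⇒walk f y w e)

  ancestor-down : ∀ f t c → AncestorOf t c → layer c + f ≤ layer t → layer c + f < i →
                  ∃ λ w → descendant f c w ≡ true × AncestorOf t w
  ancestor-down zero    t c anc _ _ = c , descendant-refl c , anc
  ancestor-down (suc f) t c anc c+f<t c+f<i with ancestor-step anc c<t
    where
      c<t : layer c < layer t
      c<t = ≤-trans (s≤s (m≤m+n (layer c) f)) (≤-trans (≤-reflexive (sym (+-suc (layer c) f))) c+f<t)
  ... | z , c~z , layer-z , anc-z
    with ancestor-down f t z anc-z (≤-trans (≤-reflexive z+f) c+f<t) (≤-trans (s≤s (≤-reflexive z+f)) c+f<i)
    where
      z+f : layer z + f ≡ layer c + suc f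
      z+f = trans (cong (_+ f) layer-z) (sym (+-suc (layer c) f))
  ... | w , desc , anc-w = w , descendant-suc⁺ {f} (child⁺ c~z layer-z z<i) desc , anc-w
    where
      z+f : layer z + f ≡ layer c + suc f
      z+f = trans (cong (_+ f) layer-z) (sym (+-suc (layer c) f))
      z<i : layer z < i
      z<i = ≤-trans (s≤s (≤-trans (m≤m+n (layer z) f) (≤-reflexive z+f))) c+f<i

  record HeavyEnd (X : Fin n → Bool) (f : ℕ) (c : Fin n) (end : ℕ × Fin n) : Set where
    constructor heavyEnd
    field
      depth         : layer (proj₂ end) + proj₁ end ≡ j
      below         : ∀ w → descendant (proj₁ end) (proj₂ end) w ≡ true → descendant f c w ≡ true
      heavy         : Heavy X (proj₁ end) (proj₂ end)
      lightChildren : ∀ f′ → proj₁ end ≡ suc f′ → ∀ y → y ∈ children (proj₂ end) → ¬ Heavy X f′ y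

  heavyPath-spec : ∀ X f x → layer x + f ≡ j → Heavy X f x → HeavyEnd X f x (heavyPath X f x)
  heavyPath-spec X zero    x depth heavy = heavyEnd depth (λ _ desc → desc) heavy (λ _ ())
  heavyPath-spec X (suc f) x depth heavy with any? (heavy? X f) (children x)
  ... | no  noHeavyChild = heavyEnd depth (λ _ desc → desc) heavy (λ { _ refl y y∈ hy → noHeavyChild (lose y∈ hy) })
  ... | yes heavyChild with y , y∈ , hy ← find heavyChild =
    let heavyEnd depth′ below′ heavy′ light′ = heavyPath-spec X f y depth-y hy
    in  heavyEnd depth′ (λ w desc → descendant-suc⁺ {f} y∈ (below′ w desc)) heavy′ light′
    where
      depth-y : layer y + f ≡ j
      depth-y = trans (cong (_+ f) (proj₁ (proj₂ (child⁻ y∈)))) (trans (sym (+-suc (layer x) f)) depth)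

  module Phase1 (u : Fin n) (layer-u : layer u ≡ i) where
    open FindAncestor u

    FoundAmong : List (Fin n) → Maybe (Fin n) → Set
    FoundAmong ys (just y) = y ∈ ys × AncestorOf u y
    FoundAmong ys nothing  = ∀ y → y ∈ ys → ¬ AncestorOf u y

    firstAncestor-spec : ∀ ys → FoundAmong ys (run (firstAncestor ys) d)
    firstAncestor-spec []       = λ _ ()
    firstAncestor-spec (y ∷ ys) with d y u + layer y ≡ᵇ i in test
    ... | true  = here refl , trans (≡ᵇ≡true⇒≡ test) (sym layer-u)
    ... | false = skip (run (firstAncestor ys) d) (firstAncestor-spec ys)
      where
        skip : ∀ r → FoundAmong ys r → FoundAmong (y ∷ ys) r
        skip (just z) (z∈ , anc) = there z∈ , anc
        skip nothing  none       = λ { z (here refl) anc → ≡ᵇ≡false⇒≢ test (trans anc layer-u)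
                                     ; z (there z∈) → none z z∈ }

    queries-firstAncestor : ∀ ys → queries (firstAncestor ys) d ≤ length ys
    queries-firstAncestor []       = z≤n
    queries-firstAncestor (y ∷ ys) with d y u + layer y ≡ᵇ i
    ... | true  = s≤s z≤n
    ... | false = s≤s (queries-firstAncestor ys)

    vertex : State → Fin n
    vertex = proj₁

    height : State → ℕ
    height = proj₁ ∘ proj₂

    candidates : State → Fin n → Bool
    candidates = proj₂ ∘ proj₂

    record Invariant (st : State) : Set where
      constructor invariant
      field
        depth      : layer (vertex st) + height st ≡ j
        ancestor   : AncestorOf u (vertex st)
        ⊆below     : ∀ w → candidates st w ≡ true → descendant (height st) (vertex st) w ≡ true
        ancestors∈ : ∀ w → descendant (height st) (vertex st) w ≡ true → AncestorOf u w → candidates st w ≡ true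

    Halves : State → State → Set
    Halves st st′ = Invariant st′ × 2 * count (candidates st′) ≤ count (candidates st)

    refine-spec : ∀ c f X f′ x → Invariant (c , f , X) → HeavyEnd X f c (suc f′ , x) →
                  ∀ r → FoundAmong (children x) r → Halves (c , f , X) (refine (c , f , X) f′ x r)
    refine-spec c f X f′ x inv end (just y) (y∈ , anc-y) =
      invariant depth-y anc-y (λ w e → ∧-conicalʳ (X w) _ e)
                (λ w desc anc → cong₂ _∧_ (ancestors∈ w (below w (descendant-suc⁺ {f′} y∈ desc)) anc) desc)
      , ≮⇒≥ (lightChildren f′ refl y y∈)
      where
        open Invariant inv using (ancestors∈)
        open HeavyEnd end using (below; lightChildren; depth)
        depth-y : layer y + f′ ≡ j
        depth-y = trans (cong (_+ f′) (proj₁ (proj₂ (child⁻ y∈)))) (trans (sym (+-suc (layer x) f′)) depth)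
    refine-spec c f X f′ x inv end nothing none =
      invariant depth ancestor (λ w e → ⊆below w (∧-conicalˡ (X w) _ e))
                (λ w desc anc → cong₂ _∧_ (ancestors∈ w desc anc) (not-below w anc))
      , countIn-removeHeavy X (descendant (suc f′) x) (allFin n) heavy
      where
        open Invariant inv
        open HeavyEnd end using (heavy)
        not-below : ∀ w → AncestorOf u w → not (descendant (suc f′) x w) ≡ true
        not-below w anc with descendant (suc f′) x w in desc
        ... | false = refl
        ... | true with y , y∈ , desc′ ← descendant-suc⁻ {f′} desc = ⊥-elim (none y y∈ (ancestor-up {f′} desc′ anc))

    roundAt-spec : ∀ c f X → Invariant (c , f , X) → 2 ≤ count X → ∀ end → HeavyEnd X f c end →
                   Halves (c , f , X) (run (roundAt (c , f , X) end) d) × queries (roundAt (c , f , X) end) d ≤ Δ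
    roundAt-spec c f X inv 2≤X (zero , x) end = ⊥-elim (<⇒≱ 2≤X (≤-pred (≤-trans heavy (*-monoʳ-≤ 2 atMostOne))))
      where
        open HeavyEnd end using (heavy)
        atMostOne : count (λ w → X w ∧ descendant 0 x w) ≤ 1
        atMostOne = count-≤1 _ (λ a b ea eb → trans (sym (descendant-zero⁻ {x} (∧-conicalʳ (X a) _ ea)))
                                                        (descendant-zero⁻ {x} (∧-conicalʳ (X b) _ eb)))
    roundAt-spec c f X inv 2≤X (suc f′ , x) end
      rewrite run->>= (firstAncestor (children x)) (ret ∘ refine (c , f , X) f′ x) d
            | queries->>= (firstAncestor (children x)) (ret ∘ refine (c , f , X) f′ x) d
      = refine-spec c f X f′ x inv end _ (firstAncestor-spec (children x))
      , ≤-trans (≤-reflexive (+-identityʳ _)) (≤-trans (queries-firstAncestor (children x)) (length-children≤Δ x))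

    round-spec : ∀ c f X → Invariant (c , f , X) → 2 ≤ count X →
                 Halves (c , f , X) (run (round (c , f , X)) d) × queries (round (c , f , X)) d ≤ Δ
    round-spec c f X inv 2≤X = roundAt-spec c f X inv 2≤X (heavyPath X f c) (heavyPath-spec X f c depth c-heavy)
      where
        open Invariant inv using (depth; ⊆below)
        c-heavy : Heavy X f c
        c-heavy = begin-strict
          count X                                   <⟨ m<m+n (count X) (≤-trans (s≤s z≤n) 2≤X) ⟩
          count X + count X                         ≤⟨ +-monoʳ-≤ (count X) (≤-reflexive (sym (+-identityʳ _))) ⟩
          2 * count X                               ≤⟨ *-monoʳ-≤ 2 (countIn-mono (λ w e → cong₂ _∧_ e (⊆below w e)) (allFin n)) ⟩
          2 * count (λ w → X w ∧ descendant f c w)  ∎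
          where open ≤-Reasoning

    Found : Fin n → Set
    Found w = layer w ≡ j × AncestorOf u w

    pick-spec : ∀ c f X → Invariant (c , f , X) → count X ≤ 1 → Found (pick X)
    pick-spec c f X (invariant depth ancestor ⊆below ancestors∈) X≤1
      with w₀ , desc , anc ← ancestor-down f u c ancestor
                               (≤-trans (≤-reflexive depth) (≤-trans (<⇒≤ j<i) (≤-reflexive (sym layer-u))))
                               (≤-trans (s≤s (≤-reflexive depth)) j<i)
      with any? (T? ∘ X) (allFin n)
    ... | no  noneInX = ⊥-elim (noneInX (lose (∈-allFin w₀) (≡true⇒T (ancestors∈ w₀ desc anc))))
    ... | yes someInX with y , _ , Xy ← find someInX
      with refl ← count≤1⇒≡ X X≤1 (T⇒≡true Xy) (ancestors∈ w₀ desc anc)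
      = trans (proj₁ (descendant⇒walk f c y desc)) depth , anc

    rounds-spec : ∀ r st → Invariant st → count (candidates st) ≤ 2 ^ r →
                  Found (run (rounds r st) d) × queries (rounds r st) d ≤ r * Δ
    rounds-spec r (c , f , X) inv X≤2^r with count X ≤? 1
    rounds-spec r       (c , f , X) inv X≤2^r | yes X≤1 = pick-spec c f X inv X≤1 , z≤n
    rounds-spec zero    (c , f , X) inv X≤2^r | no  X≰1 = ⊥-elim (X≰1 X≤2^r)
    rounds-spec (suc r) (c , f , X) inv X≤2^r | no  X≰1
      rewrite run->>= (round (c , f , X)) (rounds r) d | queries->>= (round (c , f , X)) (rounds r) d
      with (inv′ , halved) , q-round ← round-spec c f X inv (≰⇒> X≰1)
      with found , q-rest ← rounds-spec r (run (round (c , f , X)) d) inv′ (*-cancelˡ-≤ 2 (≤-trans halved X≤2^r))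
      = found , +-mono-≤ q-round q-rest

    findAncestor-spec : Found (run findAncestor d) × queries findAncestor d ≤ ⌈log₂ n ⌉ * Δ
    findAncestor-spec = rounds-spec ⌈log₂ n ⌉ (s , j , descendant j s) initial
      (begin
        count (descendant j s)  ≤⟨ countIn≤length (descendant j s) (allFin n) ⟩
        length (allFin n)       ≡⟨ length-tabulate (λ x → x) ⟩
        n                       ≤⟨ n≤2^⌈log₂n⌉ n ⟩
        2 ^ ⌈log₂ n ⌉           ∎)
      where
        open ≤-Reasoning
        initial : Invariant (s , j , descendant j s)
        initial = invariant (cong (_+ j) layer-root) (root-ancestor u) (λ _ desc → desc) (λ _ desc _ → desc)

  anchor : Fin n → Fin n
  anchor = run anchors d

  ∈layerᵢ : ∀ {u} → layer u ≡ i → u ∈ layerᵢ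
  ∈layerᵢ {u} layer-u = ∈-filterᵇ⁺ (λ v → layer v ≡ᵇ i) (allFin n) (∈-allFin u) (≡⇒≡ᵇ≡true layer-u)

  anchor-spec : ∀ u → layer u ≡ i → layer (anchor u) ≡ j × AncestorOf u (anchor u)
  anchor-spec u layer-u rewrite run-forEach-∈ s FindAncestor.findAncestor d layerᵢ (∈layerᵢ layer-u) =
    proj₁ (Phase1.findAncestor-spec u layer-u)

  samePart-spec : ∀ x y → layer x ≡ j → layer y ≡ j →
                  (samePart x y ≡ true → d x y ≤ ℓ) × (SamePart G d s j x y → samePart x y ≡ true)
  samePart-spec x y layer-x layer-y with k ≡ᵇ 0 in k≡0
  ... | true  = (λ _ → subst (λ z → d x z ≤ ℓ) x≡y (≤-trans (≤-reflexive (d-refl x)) z≤n)) , (λ _ → refl)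
    where
      j≡0 : j ≡ 0
      j≡0 = cong (_∸ 1) (≡ᵇ≡true⇒≡ {k} {0} k≡0)
      x≡y : x ≡ y
      x≡y = trans (sym (d≡0⇒≡ (trans layer-x j≡0))) (d≡0⇒≡ (trans layer-y j≡0))
  ... | false = (lengthBound j x y ∘ Equivalence.to parts) , Equivalence.from parts
    where
      j<k : j < k
      j<k = ∸-monoʳ-< (s≤s z≤n) (n≢0⇒n>0 (≡ᵇ≡false⇒≢ k≡0))
      parts = part-spec j x y j<k layer-x layer-y

  ancestorWalk : ∀ {t y} → layer y ≡ j → AncestorOf t y → WalkIn G (λ w → j ≤ layer w) y t (d y t)
  ancestorWalk layer-y anc = mapʷ (≤-trans (≤-reflexive (sym layer-y))) (ancestor-walk _ refl anc)

  samePart-across : ∀ {u v x y} → layer u ≡ i → adj G u v ≡ true → layer x ≡ j → layer y ≡ j →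
                    AncestorOf u x → AncestorOf v y → samePart x y ≡ true
  samePart-across {u} {v} {x} {y} layer-u u~v layer-x layer-y anc-x anc-y =
    proj₂ (samePart-spec x y layer-x layer-y) (layer-x , layer-y , _ ,
      (ancestorWalk layer-x anc-x ++ʷ step j≤u u~v (reverseʷ (ancestorWalk layer-y anc-y))))
    where
      j≤u : j ≤ layer u
      j≤u = ≤-trans (<⇒≤ j<i) (≤-reflexive (sym layer-u))

  i∸j≤ℓ+3 : i ∸ j ≤ ℓ + 3
  i∸j≤ℓ+3 = [k+ℓ+2]∸[k∸1]≤ℓ+3 k ℓ

  layer-j-ancestor : ∀ v → j ≤ layer v → ∃ λ b → layer b ≡ j × AncestorOf v b
  layer-j-ancestor v j≤v
    with b , desc , anc ← ancestor-down j v s (root-ancestor v) (≤-trans (≤-reflexive (cong (_+ j) layer-root)) j≤v)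
                                                               (≤-trans (s≤s (≤-reflexive (cong (_+ j) layer-root))) j<i)
    = b , trans (proj₁ (descendant⇒walk j s b desc)) (cong (_+ j) layer-root) , anc

  j≤i∸1 : j ≤ i ∸ 1
  j≤i∸1 = ∸-monoˡ-≤ 1 j<i

  lower-neighbour : ∀ {u v} → layer u ≡ i → adj G u v ≡ true → layer v < i → layer v ≡ i ∸ 1
  lower-neighbour {u} {v} layer-u u~v v<i =
    cong (_∸ 1) (sym (≤-antisym (≤-trans (≤-reflexive (sym layer-u)) (adj⇒layer≤suc (trans (Graph.sym G v u) u~v))) v<i))

  ancestor⇒descendant : ∀ f v c → AncestorOf v c → layer c + f ≡ layer v → layer v < i → descendant f c v ≡ true
  ancestor⇒descendant f v c anc c+f≡v v<i
    with w , desc , anc-w ← ancestor-down f v c anc (≤-reflexive c+f≡v) (≤-trans (s≤s (≤-reflexive c+f≡v)) v<i)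
    with refl ← ancestor-sameLayer⇒≡ anc-w (trans (proj₁ (descendant⇒walk f c w desc)) c+f≡v) = desc

  module _ (a : Fin n → Fin n) (u w : Fin n) where

    ViaPart ViaAnchor : Set
    ViaPart   = layer w ≡ i ∸ 1 × ∃ λ b → layer b ≡ j × samePart (a u) b ≡ true × descendant (i ∸ 1 ∸ j) b w ≡ true
    ViaAnchor = layer w ≡ i × samePart (a u) (a w) ≡ true

    candidate-viaPart : ViaPart → candidate a u w ≡ true
    candidate-viaPart (layer-w , b , layer-b , au~b , desc) =
      cong (_∨ anchorCandidate a u w) (cong₂ _∧_ (≡⇒≡ᵇ≡true layer-w) (any-intro _ (allFin n) (∈-allFin b)
        (cong₂ _∧_ (≡⇒≡ᵇ≡true layer-b) (cong₂ _∧_ au~b desc))))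

    candidate-viaAnchor : ViaAnchor → candidate a u w ≡ true
    candidate-viaAnchor (layer-w , au~aw) =
      trans (cong (partCandidate a u w ∨_) (cong₂ _∧_ (≡⇒≡ᵇ≡true layer-w) au~aw)) (∨-zeroʳ _)

    candidate-cases : candidate a u w ≡ true → ViaPart ⊎ ViaAnchor
    candidate-cases cand with ∨≡true⇒⊎ {partCandidate a u w} cand
    ... | inj₂ viaAnchor = inj₂ (≡ᵇ≡true⇒≡ (∧-conicalˡ (layer w ≡ᵇ i) _ viaAnchor) , ∧-conicalʳ (layer w ≡ᵇ i) _ viaAnchor)
    ... | inj₁ viaPart with b , _ , e ← any-elim _ (allFin n) (∧-conicalʳ (layer w ≡ᵇ i ∸ 1) _ viaPart) =
      inj₁ (≡ᵇ≡true⇒≡ (∧-conicalˡ (layer w ≡ᵇ i ∸ 1) _ viaPart) , b , ≡ᵇ≡true⇒≡ (∧-conicalˡ (layer b ≡ᵇ j) _ e)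
           , ∧-conicalˡ (samePart (a u) b) _ (∧-conicalʳ (layer b ≡ᵇ j) _ e)
           , ∧-conicalʳ (samePart (a u) b) _ (∧-conicalʳ (layer b ≡ᵇ j) _ e))

  complete : ∀ u v → layer u ≡ i → adj G u v ≡ true → layer v ≤ i → candidate anchor u v ≡ true
  complete u v layer-u u~v v≤i with anchor-spec u layer-u | m≤n⇒m<n∨m≡n v≤i
  ... | layer-au , anc-au | inj₂ layer-v with layer-av , anc-av ← anchor-spec v layer-v =
    candidate-viaAnchor anchor u v (layer-v , samePart-across layer-u u~v layer-au layer-av anc-au anc-av)
  ... | layer-au , anc-au | inj₁ v<i
    with layer-v ← lower-neighbour layer-u u~v v<i
    with b , layer-b , anc-b ← layer-j-ancestor v (≤-trans j≤i∸1 (≤-reflexive (sym layer-v))) =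
    candidate-viaPart anchor u v (layer-v , b , layer-b , samePart-across layer-u u~v layer-au layer-b anc-au anc-b
                                 , ancestor⇒descendant (i ∸ 1 ∸ j) v b anc-b b+f≡v v<i)
    where
      b+f≡v : layer b + (i ∸ 1 ∸ j) ≡ layer v
      b+f≡v = trans (cong (_+ (i ∸ 1 ∸ j)) layer-b) (trans (m+[n∸m]≡n j≤i∸1) (sym layer-v))

  sound : ∀ u w → layer u ≡ i → candidate anchor u w ≡ true → d (anchor u) w ≤ ℓ + (ℓ + 3)
  sound u w layer-u cand with anchor-spec u layer-u | candidate-cases anchor u w cand
  ... | layer-au , _ | inj₁ (_ , b , layer-b , au~b , desc) = begin
      d (anchor u) w          ≤⟨ d-triangle (anchor u) b w ⟩
      d (anchor u) b + d b w  ≤⟨ +-mono-≤ (proj₁ (samePart-spec (anchor u) b layer-au layer-b) au~b)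
                                          (d≤length (proj₂ (descendant⇒walk (i ∸ 1 ∸ j) b w desc))) ⟩
      ℓ + (i ∸ 1 ∸ j)         ≤⟨ +-monoʳ-≤ ℓ (≤-trans (∸-monoˡ-≤ j (m∸n≤m i 1)) i∸j≤ℓ+3) ⟩
      ℓ + (ℓ + 3)             ∎
    where open ≤-Reasoning
  ... | layer-au , _ | inj₂ (layer-w , au~aw) with layer-aw , anc-aw ← anchor-spec w layer-w = begin
      d (anchor u) w                            ≤⟨ d-triangle (anchor u) (anchor w) w ⟩
      d (anchor u) (anchor w) + d (anchor w) w  ≤⟨ +-mono-≤ (proj₁ (samePart-spec (anchor u) (anchor w) layer-au layer-aw) au~aw)
                                                            (≤-reflexive aw-w) ⟩
      ℓ + (i ∸ j)                               ≤⟨ +-monoʳ-≤ ℓ i∸j≤ℓ+3 ⟩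
      ℓ + (ℓ + 3)                               ∎
    where
      open ≤-Reasoning
      aw-w : d (anchor w) w ≡ i ∸ j
      aw-w = begin-equality
        d (anchor w) w                         ≡⟨ sym (m+n∸n≡m (d (anchor w) w) j) ⟩
        d (anchor w) w + j ∸ j                 ≡⟨ cong (λ x → d (anchor w) w + x ∸ j) (sym layer-aw) ⟩
        d (anchor w) w + layer (anchor w) ∸ j  ≡⟨ cong (_∸ j) (trans anc-aw layer-w) ⟩
        i ∸ j                                  ∎

  isEdge-spec : ∀ u v → layer v ≤ i → run (isEdge u v) d ≡ (adj G u v ∧ (layer v <ᵇ suc i))
  isEdge-spec u v v≤i = begin
    (d u v ≡ᵇ 1)                          ≡⟨ d≡ᵇ1≡adj u v ⟩
    adj G u v                             ≡⟨ sym (∧-identityʳ (adj G u v)) ⟩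
    adj G u v ∧ true                      ≡⟨ cong (adj G u v ∧_) (sym (<⇒<ᵇ≡true (s≤s v≤i))) ⟩
    adj G u v ∧ (layer v <ᵇ suc i)        ∎
    where open ≡-Reasoning

  neighbours-spec : ∀ u v → layer u ≡ i → run (neighbours anchor u) d v ≡ (adj G u v ∧ (layer v <ᵇ suc i))
  neighbours-spec u v layer-u with candidate anchor u v in cand
  ... | true  = trans (run-forEach-∈ false (isEdge u) d _ (∈-filterᵇ⁺ (candidate anchor u) (allFin n) (∈-allFin v) cand))
                      (isEdge-spec u v v≤i)
    where
      v≤i : layer v ≤ i
      v≤i with candidate-cases anchor u v cand
      ... | inj₁ (layer-v , _) = ≤-trans (≤-reflexive layer-v) (m∸n≤m i 1)
      ... | inj₂ (layer-v , _) = ≤-reflexive layer-v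
  ... | false = trans (run-forEach-∉ false (isEdge u) d _ v∉) (sym no-edge)
    where
      v∉ : ¬ v ∈ filterᵇ (candidate anchor u) (allFin n)
      v∉ v∈ with () ← trans (sym (∈-filterᵇ⁻ (candidate anchor u) (allFin n) v∈)) cand
      no-edge : (adj G u v ∧ (layer v <ᵇ suc i)) ≡ false
      no-edge with adj G u v in u~v | layer v <ᵇ suc i in v≤i
      ... | false | _     = refl
      ... | true  | false = refl
      ... | true  | true with () ← trans (sym (complete u v layer-u u~v (≤-pred (<ᵇ≡true⇒< v≤i)))) cand

  neighbourhood : Fin n → Fin n → Bool
  neighbourhood = run (neighbourhoods anchor) d

  run-algorithm : run algorithm d ≡ extend neighbourhood
  run-algorithm = trans (run->>= anchors _ d) (run->>= (neighbourhoods anchor) _ d)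

  neighbourhood-spec : ∀ u v → layer u ≡ i → neighbourhood u v ≡ (adj G u v ∧ (layer v <ᵇ suc i))
  neighbourhood-spec u v layer-u =
    trans (cong-app (run-forEach-∈ (λ _ → false) (neighbours anchor) d layerᵢ (∈layerᵢ layer-u)) v)
          (neighbours-spec u v layer-u)

  extend-spec : ∀ u v → extend neighbourhood u v ≡ inducedBelow G d s (suc i) u v
  extend-spec u v with layer u ≡ᵇ i in u≡i
  ... | true  = trans (neighbourhood-spec u v (≡ᵇ≡true⇒≡ {layer u} u≡i))
                      (cong (λ b → adj G u v ∧ (b ∧ (layer v <ᵇ suc i))) (sym (<ᵇ1+i u≡i)))
    where
      <ᵇ1+i : ∀ {x} → (layer x ≡ᵇ i) ≡ true → (layer x <ᵇ suc i) ≡ true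
      <ᵇ1+i {x} e = <⇒<ᵇ≡true (s≤s (≤-reflexive (≡ᵇ≡true⇒≡ {layer x} e)))
  ... | false with layer v ≡ᵇ i in v≡i
  ...   | true  = begin
    neighbourhood v u                                    ≡⟨ neighbourhood-spec v u (≡ᵇ≡true⇒≡ {layer v} v≡i) ⟩
    adj G v u ∧ (layer u <ᵇ suc i)                        ≡⟨ cong₂ _∧_ (Graph.sym G v u) (sym (∧-identityʳ _)) ⟩
    adj G u v ∧ ((layer u <ᵇ suc i) ∧ true)               ≡⟨ cong (λ b → adj G u v ∧ ((layer u <ᵇ suc i) ∧ b)) (sym v<ᵇ1+i) ⟩
    adj G u v ∧ ((layer u <ᵇ suc i) ∧ (layer v <ᵇ suc i)) ∎
    where
      open ≡-Reasoning
      v<ᵇ1+i : (layer v <ᵇ suc i) ≡ true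
      v<ᵇ1+i = <⇒<ᵇ≡true (s≤s (≤-reflexive (≡ᵇ≡true⇒≡ {layer v} v≡i)))
  ...   | false = trans (Gᵢ-spec u v)
                        (cong (adj G u v ∧_) (cong₂ _∧_ (<ᵇ-suc (layer u) i (≡ᵇ≡false⇒≢ u≡i))
                                                         (<ᵇ-suc (layer v) i (≡ᵇ≡false⇒≢ v≡i))))

  Bound : ℕ
  Bound = Δ ^ (ℓ + 2) * ⌈log₂ n ⌉ + Δ ^ (4 * ℓ + 8)

  queries-neighbours : ∀ u → layer u ≡ i → queries (neighbours anchor u) d ≤ Δ ^ (4 * ℓ + 8)
  queries-neighbours u layer-u = begin
    queries (neighbours anchor u) d                  ≡⟨ queries-forEach false (isEdge u) d candidates ⟩
    sum (map (λ _ → 1) candidates)                   ≤⟨ sum-map-≤ (λ _ → 1) 1 candidates (λ _ _ → ≤-refl) ⟩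
    length candidates * 1                            ≡⟨ *-identityʳ _ ⟩
    length candidates                                ≡⟨ length-filterᵇ (candidate anchor u) (allFin n) ⟩
    count (candidate anchor u)                       ≤⟨ countIn-mono (λ w cand → ≤⇒≤ᵇ≡true (sound u w layer-u cand)) (allFin n) ⟩
    count (ball (anchor u) (ℓ + (ℓ + 3)))            ≤⟨ count-ball (anchor u) (ℓ + (ℓ + 3)) ⟩
    suc Δ ^ (ℓ + (ℓ + 3))                            ≤⟨ [1+Δ]^[ℓ+[ℓ+3]]≤Δ^[4ℓ+8] Δ ℓ 2≤Δ ⟩
    Δ ^ (4 * ℓ + 8)                                  ∎
    where
      open ≤-Reasoning
      candidates = filterᵇ (candidate anchor u) (allFin n)
      2≤Δ = 2≤layer⇒2≤Δ s u (≤-trans (m≤n+m 2 (k + ℓ)) (≤-reflexive (sym layer-u)))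

  queries-findAncestor : ∀ u → layer u ≡ i → queries (FindAncestor.findAncestor u) d ≤ Δ ^ (ℓ + 2) * ⌈log₂ n ⌉
  queries-findAncestor u layer-u =
    ≤-trans (proj₂ (Phase1.findAncestor-spec u layer-u))
            (m*n≤n^e*m ⌈log₂ n ⌉ Δ (ℓ + 2) (≤-trans (s≤s z≤n) (m≤n+m 2 ℓ)))

  vertexCost : Fin n → ℕ
  vertexCost u = queries (FindAncestor.findAncestor u) d + queries (neighbours anchor u) d

  queries-algorithm : queries algorithm d ≡ sum (map vertexCost layerᵢ)
  queries-algorithm = begin
    queries algorithm d                                                       ≡⟨ queries->>= anchors _ d ⟩
    queries anchors d + queries (neighbourhoods anchor >>= (ret ∘ extend)) d  ≡⟨ cong (queries anchors d +_) (queries->>= (neighbourhoods anchor) _ d) ⟩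
    queries anchors d + (queries (neighbourhoods anchor) d + 0)               ≡⟨ cong (queries anchors d +_) (+-identityʳ _) ⟩
    queries anchors d + queries (neighbourhoods anchor) d                     ≡⟨ cong₂ _+_ (queries-forEach s FindAncestor.findAncestor d layerᵢ)
                                                                                           (queries-forEach (λ _ → false) (neighbours anchor) d layerᵢ) ⟩
    sum (map (λ u → queries (FindAncestor.findAncestor u) d) layerᵢ) + sum (map (λ u → queries (neighbours anchor u) d) layerᵢ)
                                                                              ≡⟨ sym (sum-map-+ _ _ layerᵢ) ⟩
    sum (map vertexCost layerᵢ)                                               ∎
    where open ≡-Reasoning

  cost : queries algorithm d ≤ layerSize d s i * Bound
  cost = begin
    queries algorithm d          ≡⟨ queries-algorithm ⟩
    sum (map vertexCost layerᵢ)  ≤⟨ sum-map-≤ vertexCost Bound layerᵢ vertexCost≤Bound ⟩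
    length layerᵢ * Bound        ≡⟨ cong (_* Bound) (length-filterᵇ _ (allFin n)) ⟩
    layerSize d s i * Bound      ∎
    where
      open ≤-Reasoning
      vertexCost≤Bound : ∀ u → u ∈ layerᵢ → vertexCost u ≤ Bound
      vertexCost≤Bound u u∈ = +-mono-≤ (queries-findAncestor u layer-u) (queries-neighbours u layer-u)
        where
          layer-u : layer u ≡ i
          layer-u = ≡ᵇ≡true⇒≡ (∈-filterᵇ⁻ (λ v → layer v ≡ᵇ i) (allFin n) u∈)

  correct : ∀ u v → run algorithm d u v ≡ inducedBelow G d s (i + 1) u v
  correct u v = begin
    run algorithm d u v                    ≡⟨ cong (λ g → g u v) run-algorithm ⟩
    extend neighbourhood u v               ≡⟨ extend-spec u v ⟩
    inducedBelow G d s (suc i) u v         ≡⟨ cong (λ m → inducedBelow G d s m u v) (+-comm 1 i) ⟩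
    inducedBelow G d s (i + 1) u v         ∎
    where open ≡-Reasoning

lemma10 : Σ Algorithm λ A → ∃ λ C →
    ∀ (n : ℕ) (G : Graph n) (d : Fin n → Fin n → ℕ) (Δ : ℕ) (s : Fin n) (ℓ k : ℕ)
      (Gi : Fin n → Fin n → Bool) (part : Fin n → Fin n → Bool) →
    Connected G → IsDist G d → MaxDegree G Δ → LengthBound G d s ℓ →
    (∀ u v → Gi u v ≡ inducedBelow G d s (k + ℓ + 2) u v) →
    (∀ j u v → j < k → d s u ≡ j → d s v ≡ j → (part u v ≡ true ⇔ SamePart G d s j u v)) →
    let alg = A n Δ ℓ k s (d s) Gi part in
    (∀ u v → run alg d u v ≡ inducedBelow G d s (k + ℓ + 2 + 1) u v)
    × queries alg d ≤ C * (layerSize d s (k + ℓ + 2)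
                          * (Δ ^ (ℓ + 2) * ⌈log₂ n ⌉ + Δ ^ (4 * ℓ + 8)))
lemma10 = (λ n _ ℓ k → Algorithm.algorithm n ℓ k) , 1 ,
  λ n G d Δ s ℓ k Gᵢ part _ isDist maxDegree lengthBound Gᵢ-spec part-spec →
    let open Correctness G d Δ ℓ k s Gᵢ part isDist maxDegree lengthBound Gᵢ-spec part-spec
    in correct , ≤-trans cost (≤-reflexive (sym (*-identityˡ _)))
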